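{- Let $G$ be an $SQSR(12, 4, 0; 3, 2, 1)$ graph. Let $x, y$ be non-adjacent vertices of $G$ with $N(x) \cap N(y) = Z = \{z_1, z_2, z_3\}$, and let $N(x) \setminus Z = \{x_1\}$ and $N(y) \setminus Z = \{y_1\}$. Let $H$ be the subgraph of $G$ induced by $V(G) \setminus (\{x, y, x_1, y_1\} \cup Z)$. Then every vertex of $H$ is adjacent to at least one vertex of $Z$.
   Context: All graphs are finite and simple; $N(v)$ is the set of neighbours of $v$. A $QSR(n,k,a;c_1,\ldots,c_p)$ graph is a $k$-regular graph on $n$ vertices such that any two adjacent vertices have exactly $a$ common neighbours and any two distinct non-adjacent vertices have exactly $c_i$ common neighbours for some $1 \le i \le p$. Its grade is the number of indices $i$ for which there actually exist two non-adjacent vertices with exactly $c_i$ common neighbours; it is proper if its grade is $p$. An $SQSR(n,k,a;c_1,\ldots,c_p)$ graph is a proper $QSR(n,k,a;c_1,\ldots,c_p)$ graph in which $a, c_1, \ldots, c_p$ are pairwise distinct. -}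

module Defs where

open import Data.Nat using (ℕ)
open import Data.Bool using (Bool; true; false; _∧_)
open import Data.Fin using (Fin)
open import Data.List using (List; _∷_; length; filterᵇ; allFin)
open import Data.List.Membership.Propositional using (_∈_)
open import Data.List.Relation.Unary.Unique.Propositional using (Unique)
open import Data.List.Relation.Unary.All using (All)
open import Data.Product using (Σ; _×_; ∃; ∃-syntax)
open import Relation.Binary.PropositionalEquality using (_≡_; _≢_)

record Graph (n : ℕ) : Set where
  field
    adj    : Fin n → Fin n → Bool
    symm   : ∀ u v → adj u v ≡ adj v u
    irrefl : ∀ v → adj v v ≡ false

open Graph public

Adj : ∀ {n} → Graph n → Fin n → Fin n → Set
Adj G u v = adj G u v ≡ true

NonAdj : ∀ {n} → Graph n → Fin n → Fin n → Set
NonAdj G u v = adj G u v ≡ false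

degree : ∀ {n} → Graph n → Fin n → ℕ
degree {n} G v = length (filterᵇ (adj G v) (allFin n))

common : ∀ {n} → Graph n → Fin n → Fin n → ℕ
common {n} G u v = length (filterᵇ (λ w → adj G u w ∧ adj G v w) (allFin n))

-- QSR(n,k,a; c_1,...,c_p), the list cs = c_1 ∷ ... ∷ c_p
record QSR {n : ℕ} (G : Graph n) (k a : ℕ) (cs : List ℕ) : Set where
  field
    regular : ∀ v → degree G v ≡ k
    adjCommon : ∀ u v → Adj G u v → common G u v ≡ a
    nonAdjCommon : ∀ u v → u ≢ v → NonAdj G u v → common G u v ∈ cs

-- Proper: grade = p, i.e. every index i is realised by some pair of
-- distinct non-adjacent vertices with exactly c_i common neighbours.
Realised : ∀ {n} → Graph n → ℕ → Set
Realised G c = ∃[ u ] ∃[ v ] (u ≢ v × NonAdj G u v × common G u v ≡ c)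

record SQSR {n : ℕ} (G : Graph n) (k a : ℕ) (cs : List ℕ) : Set where
  field
    qsr      : QSR G k a cs
    proper   : All (Realised G) cs
    distinct : Unique (a ∷ cs)

{-# OPTIONS --safe #-}
-- G is triangle-free (a = 0) and any two distinct non-adjacent vertices have a common
-- neighbour (every cᵢ > 0). Then x₁ ~ y₁: a common neighbour of x₁ and y lies in
-- N(y) = Z ∪ {y₁}, and it cannot be in Z since x, x₁, z would form a triangle.
-- A vertex v of H is adjacent to neither x nor y, so it has a common neighbour with x
-- in Z ∪ {x₁} and one with y in Z ∪ {y₁}; if both avoided Z, then v, x₁, y₁ would be
-- a triangle.
module Submission where

open import Defs
open import Data.Bool using (T; _∧_)
open import Data.Bool.Properties using (T-≡; T-∧; ¬-not)
open import Data.Empty using (⊥; ⊥-elim)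
open import Data.Fin using (Fin; _≟_)
open import Data.List using (List; _∷_; []; length; filterᵇ; allFin)
open import Data.List.Membership.Propositional using (_∈_; lose)
open import Data.List.Membership.Propositional.Properties using (∈-allFin; ∈-filter⁻)
open import Data.List.Properties using (filter-some)
open import Data.List.Relation.Unary.Any using (here; there)
open import Data.Nat using (ℕ; _<_)
open import Data.Nat.Properties using (<-irrefl)
open import Data.Product using (_×_; _,_; proj₁; proj₂; ∃-syntax; map)
open import Data.Sum using (_⊎_; inj₁; inj₂; [_,_])
open import Function using (_∘_)
open import Function.Bundles using (_⇔_; Equivalence)
open import Relation.Nullary using (¬_; Dec; yes; no)
open import Relation.Nullary.Decidable using (T?; _⊎-dec_)
open import Relation.Binary.PropositionalEquality using (_≡_; _≢_; refl; sym; trans; subst)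

splitBy : ∀ {P A Q : Set} → Dec P → ((A × ¬ P) ⇔ Q) → A → P ⊎ Q
splitBy (yes p) _   _ = inj₁ p
splitBy (no ¬p) A⇔Q a = inj₂ (Equivalence.to A⇔Q (a , ¬p))

nonEmpty⇒∃∈ : ∀ {A : Set} (xs : List A) → length xs ≢ 0 → ∃[ w ] w ∈ xs
nonEmpty⇒∃∈ []      ne = ⊥-elim (ne refl)
nonEmpty⇒∃∈ (x ∷ _) _  = x , here refl

module _ {n : ℕ} (G : Graph n) where

  Adj-sym : ∀ {u v} → Adj G u v → Adj G v u
  Adj-sym {u} {v} = trans (symm G v u)

  ¬Adj⇒NonAdj : ∀ {u v} → ¬ Adj G u v → NonAdj G u v
  ¬Adj⇒NonAdj = ¬-not

  commonNeighbours : Fin n → Fin n → List (Fin n)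
  commonNeighbours u v = filterᵇ (λ w → adj G u w ∧ adj G v w) (allFin n)

  T-adj∧adj⇔ : ∀ {u v w} → T (adj G u w ∧ adj G v w) ⇔ (Adj G u w × Adj G v w)
  T-adj∧adj⇔ = record
    { to   = map (Equivalence.to T-≡) (Equivalence.to T-≡) ∘ Equivalence.to T-∧
    ; from = Equivalence.from T-∧ ∘ map (Equivalence.from T-≡) (Equivalence.from T-≡)
    ; to-cong = λ { refl → refl } ; from-cong = λ { refl → refl }
    }

  common≡0⇒noCommonNeighbour : ∀ {u v w} → common G u v ≡ 0 →
    ¬ (Adj G u w × Adj G v w)
  common≡0⇒noCommonNeighbour {u} {v} {w} c≡0 uw,vw = <-irrefl refl (subst (0 <_) c≡0 0<c)
    where
    0<c : 0 < common G u v
    0<c = filter-some (T? ∘ λ t → adj G u t ∧ adj G v t)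
            (lose (∈-allFin w) (Equivalence.from T-adj∧adj⇔ uw,vw))

  common≢0⇒commonNeighbour : ∀ {u v} → common G u v ≢ 0 →
    ∃[ w ] Adj G u w × Adj G v w
  common≢0⇒commonNeighbour {u} {v} c≢0 with nonEmpty⇒∃∈ (commonNeighbours u v) c≢0
  ... | w , w∈ = w , Equivalence.to T-adj∧adj⇔
                       (proj₂ (∈-filter⁻ (T? ∘ λ t → adj G u t ∧ adj G v t) {xs = allFin n} w∈))

  TriangleFree : Set
  TriangleFree = ∀ {u v w} → Adj G u v → Adj G u w → Adj G v w → ⊥

  NonAdjacentMeet : Set
  NonAdjacentMeet = ∀ {u v} → u ≢ v → NonAdj G u v → ∃[ w ] Adj G u w × Adj G v w

  QSR-a≡0⇒triangleFree : ∀ {k cs} → QSR G k 0 cs → TriangleFree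
  QSR-a≡0⇒triangleFree q uv uw vw =
    common≡0⇒noCommonNeighbour (QSR.adjCommon q _ _ uv) (uw , vw)

  QSR-0∉cs⇒nonAdjacentMeet : ∀ {k a cs} → QSR G k a cs → ¬ 0 ∈ cs → NonAdjacentMeet
  QSR-0∉cs⇒nonAdjacentMeet q 0∉cs u≢v u≁v =
    common≢0⇒commonNeighbour λ c≡0 → 0∉cs (subst (_∈ _) c≡0 (QSR.nonAdjCommon q _ _ u≢v u≁v))

  module _ (triangleFree : TriangleFree) (meet : NonAdjacentMeet)
           {x y x₁ y₁ : Fin n} {Z : Fin n → Set} (x≁y : NonAdj G x y)
           (common⇔Z : ∀ {w} → (Adj G x w × Adj G y w) ⇔ Z w)
           (N[x]⊆ : ∀ {w} → Adj G x w → Z w ⊎ w ≡ x₁)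
           (N[y]⊆ : ∀ {w} → Adj G y w → Z w ⊎ w ≡ y₁)
           (x~x₁ : Adj G x x₁) (x₁∉Z : ¬ Z x₁) where

    x₁~y₁ : Adj G x₁ y₁
    x₁~y₁ with meet x₁≢y x₁≁y
      where
      x₁≢y : x₁ ≢ y
      x₁≢y refl with () ← trans (sym x~x₁) x≁y
      x₁≁y : NonAdj G x₁ y
      x₁≁y = ¬Adj⇒NonAdj λ x₁~y → x₁∉Z (Equivalence.to common⇔Z (x~x₁ , Adj-sym x₁~y))
    ... | w , x₁~w , y~w with N[y]⊆ y~w
    ...   | inj₁ w∈Z  = ⊥-elim (triangleFree x~x₁ (proj₁ (Equivalence.from common⇔Z w∈Z)) x₁~w)
    ...   | inj₂ refl = x₁~w

    private
      meetInside : ∀ {v u u₁} → v ≢ u → ¬ Z v → v ≢ u₁ →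
        (∀ {w} → Adj G u w → Z w ⊎ w ≡ u₁) → (∃[ w ] Z w × Adj G v w) ⊎ Adj G v u₁
      meetInside v≢u v∉Z v≢u₁ N[u]⊆ with meet v≢u v≁u
        where
        v≁u : NonAdj G _ _
        v≁u = ¬Adj⇒NonAdj λ v~u → [ v∉Z , v≢u₁ ] (N[u]⊆ (Adj-sym v~u))
      ... | w , v~w , u~w with N[u]⊆ u~w
      ...   | inj₁ w∈Z  = inj₁ (w , w∈Z , v~w)
      ...   | inj₂ refl = inj₂ v~w

    neighbourInZ : ∀ {v} → v ≢ x → v ≢ y → v ≢ x₁ → v ≢ y₁ → ¬ Z v →
      ∃[ w ] Z w × Adj G v w
    neighbourInZ v≢x v≢y v≢x₁ v≢y₁ v∉Z
      with meetInside v≢x v∉Z v≢x₁ N[x]⊆ | meetInside v≢y v∉Z v≢y₁ N[y]⊆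
    ... | inj₁ found | _           = found
    ... | inj₂ _     | inj₁ found  = found
    ... | inj₂ v~x₁  | inj₂ v~y₁   = ⊥-elim (triangleFree v~x₁ v~y₁ x₁~y₁)

mainTheorem8 : (G : Graph 12) → SQSR G 4 0 (3 ∷ 2 ∷ 1 ∷ []) →
    (x y z₁ z₂ z₃ x₁ y₁ : Fin 12) →
    x ≢ y → NonAdj G x y →
    z₁ ≢ z₂ → z₁ ≢ z₃ → z₂ ≢ z₃ →
    (∀ w → (Adj G x w × Adj G y w) ⇔ (w ≡ z₁ ⊎ w ≡ z₂ ⊎ w ≡ z₃)) →
    (∀ w → (Adj G x w × ¬ (w ≡ z₁ ⊎ w ≡ z₂ ⊎ w ≡ z₃)) ⇔ (w ≡ x₁)) →
    (∀ w → (Adj G y w × ¬ (w ≡ z₁ ⊎ w ≡ z₂ ⊎ w ≡ z₃)) ⇔ (w ≡ y₁)) →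
    (v : Fin 12) →
    ¬ (v ≡ x ⊎ v ≡ y ⊎ v ≡ x₁ ⊎ v ≡ y₁ ⊎ v ≡ z₁ ⊎ v ≡ z₂ ⊎ v ≡ z₃) →
    Adj G v z₁ ⊎ Adj G v z₂ ⊎ Adj G v z₃
mainTheorem8 G S x y z₁ z₂ z₃ x₁ y₁ _ x≁y _ _ _ common⇔Z N[x] N[y] v v∉ =
  adjacentToOne (neighbourInZ G triangleFree meet x≁y (common⇔Z _)
                   (splitBy (Z? _) (N[x] _)) (splitBy (Z? _) (N[y] _))
                   (proj₁ x₁∈N[x]) (proj₂ x₁∈N[x])
                   (v∉ ∘ inj₁) (v∉ ∘ inj₂ ∘ inj₁) (v∉ ∘ inj₂ ∘ inj₂ ∘ inj₁)
                   (v∉ ∘ inj₂ ∘ inj₂ ∘ inj₂ ∘ inj₁) (v∉ ∘ inj₂ ∘ inj₂ ∘ inj₂ ∘ inj₂))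
  where
  open SQSR S using (qsr)

  Z? : ∀ w → Dec (w ≡ z₁ ⊎ w ≡ z₂ ⊎ w ≡ z₃)
  Z? w = (w ≟ z₁) ⊎-dec (w ≟ z₂) ⊎-dec (w ≟ z₃)

  x₁∈N[x] : Adj G x x₁ × ¬ (x₁ ≡ z₁ ⊎ x₁ ≡ z₂ ⊎ x₁ ≡ z₃)
  x₁∈N[x] = Equivalence.from (N[x] x₁) refl

  triangleFree : TriangleFree G
  triangleFree = QSR-a≡0⇒triangleFree G qsr

  meet : NonAdjacentMeet G
  meet = QSR-0∉cs⇒nonAdjacentMeet G qsr
    λ { (there (there (there ()))) }

  adjacentToOne : ∃[ w ] (w ≡ z₁ ⊎ w ≡ z₂ ⊎ w ≡ z₃) × Adj G v w →
    Adj G v z₁ ⊎ Adj G v z₂ ⊎ Adj G v z₃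
  adjacentToOne (_ , inj₁ refl , v~w)        = inj₁ v~w
  adjacentToOne (_ , inj₂ (inj₁ refl) , v~w) = inj₂ (inj₁ v~w)
  adjacentToOne (_ , inj₂ (inj₂ refl) , v~w) = inj₂ (inj₂ v~w)
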